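{- Let $b\ge 2$, and let $N$ be a $b$-MRH number with $k$ digits in base $b$ and multiplicative multiplier $M$. Suppose one of the following holds: (i) $b\ge 9$ and $M\ge b^9$; (ii) $5\le b\le 8$ and $M\ge b^{10}$; (iii) $b=4$ and $M\ge b^{11}$; (iv) $b=3$ and $M\ge b^{12}$; (v) $b=2$ and $M\ge b^{16}$. Then $k\le 3\lfloor\log_b M\rfloor$.
   Context: For a positive integer $N$, $s_b(N)$ is the sum of the base-$b$ digits of $N$, and the reversal $N^R$ is the integer obtained by writing the base-$b$ digits of $N$ in reverse order. A positive integer $N$ is a $b$-MRH number if there exists a positive integer $M$ (called a multiplicative multiplier of $N$) such that $N=Ms_b(N)\cdot(Ms_b(N))^R$. $\lfloor x\rfloor$ is the integer part and $\log_b$ the base-$b$ logarithm. -}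

module Defs where

open import Data.Nat using (ℕ; zero; suc; _+_; _*_; _^_; _≤_; _<_; NonZero)
open import Data.Nat.DivMod using (_/_; _%_)
open import Data.List using (List; []; _∷_; foldl; length)
open import Data.Nat.ListAction using (sum)
open import Relation.Binary.PropositionalEquality using (_≡_)
open import Data.Product using (∃-syntax; _×_)

-- Base-b digits of n, least significant first (empty list for n = 0).
-- The fuel argument bounds the recursion; fuel = n suffices since n / b < n
-- for b ≥ 2 and n ≥ 1.
digitsAux : ℕ → (b : ℕ) → .{{NonZero b}} → ℕ → List ℕ
digitsAux zero    b n       = []
digitsAux (suc f) b zero    = []
digitsAux (suc f) b (suc n) = (suc n % b) ∷ digitsAux f b (suc n / b)

digits : (b : ℕ) → .{{NonZero b}} → ℕ → List ℕ
digits b n = digitsAux n b n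

digitSum : (b : ℕ) → .{{NonZero b}} → ℕ → ℕ
digitSum b n = sum (digits b n)

numDigits : (b : ℕ) → .{{NonZero b}} → ℕ → ℕ
numDigits b n = length (digits b n)

fromDigitsMSF : ℕ → List ℕ → ℕ
fromDigitsMSF b = foldl (λ acc d → acc * b + d) 0

-- reversal n^R: the digits of n (least significant first) read as the
-- most-significant-first digits of n^R
reversal : (b : ℕ) → .{{NonZero b}} → ℕ → ℕ
reversal b n = fromDigitsMSF b (digits b n)

IsMultiplier : (b : ℕ) → .{{NonZero b}} → ℕ → ℕ → Set
IsMultiplier b N M =
  1 ≤ M × N ≡ (M * digitSum b N) * reversal b (M * digitSum b N)

IsMRH : (b : ℕ) → .{{NonZero b}} → ℕ → Set
IsMRH b N = 1 ≤ N × ∃[ M ] IsMultiplier b N M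

module Submission where

-- Write k for the number of digits of N, s = s_b(N) and A = M·s, so
-- that N = A·A^R.  Three elementary digit facts give
--   (1) b^k ≤ b·N         (N has k digits),
--   (2) A^R < b^(#digits of A) ≤ b·A,   hence b^k ≤ (b·A)²,
--   (3) s ≤ (b-1)·k,      hence b·A < b^(L+2)·(b-1)·k  when M < b^(L+1).
-- So k ≥ 3L+1 would force b^k < (b^(L+2)(b-1))²·k².  The second half of the
-- file shows the opposite inequality ("b^k dominates"), for every k ≥ 3L+1
-- once L is at least a threshold L₀: it is checked directly on the diagonal
-- k = 3L₀+1, propagated along the diagonal ((L, k) ↦ (L+1, k+3) multiplies
-- b^k by b³ and the polynomial side by less than b³) and then upwards in k.
-- Each of the five hypotheses of the theorem supplies such an L₀ ≤ L.

open import Data.List using (List; []; _∷_; foldl; length)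
open import Data.List.Relation.Unary.All using (All; []; _∷_)
open import Data.Nat
open import Data.Nat.DivMod using (_/_; m%n<n; m/n*n≤m)
open import Data.Nat.ListAction using (sum)
open import Data.Nat.Properties
open import Data.Nat.Tactic.RingSolver using (solve-∀)
open import Algebra.Properties.CommutativeSemigroup *-commutativeSemigroup
  using (x∙yz≈y∙xz)
open import Data.Empty using (⊥)
open import Data.Product using (_×_; _,_; ∃-syntax)
open import Data.Sum using (_⊎_; inj₁; inj₂)
open import Data.Unit using (tt)
open import Relation.Binary.PropositionalEquality
open import Defs

sq : ℕ → ℕ
sq x = x * x

sq-* : ∀ x y → (x * y) * (x * y) ≡ (x * x) * (y * y)
sq-* = solve-∀

digitsAux-zero : ∀ f b .{{_ : NonZero b}} → digitsAux f b 0 ≡ []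
digitsAux-zero zero    b = refl
digitsAux-zero (suc f) b = refl

digits-< : ∀ f b .{{_ : NonZero b}} n → All (_< b) (digitsAux f b n)
digits-< zero    b n       = []
digits-< (suc f) b zero    = []
digits-< (suc f) b (suc n) = m%n<n (suc n) b ∷ digits-< f b (suc n / b)

-- A positive number with ℓ digits is at least b^(ℓ-1), i.e. b^ℓ ≤ b·n.
-- (This holds for any fuel: too little fuel only shortens the expansion.)
length-digits-lower : ∀ f b .{{_ : NonZero b}} n → 1 ≤ n →
  b ^ length (digitsAux f b n) ≤ b * n
length-digits-lower zero    b n 1≤n = *-mono-≤ (>-nonZero⁻¹ b) 1≤n
length-digits-lower (suc f) b (suc n) _ =
  *-monoʳ-≤ b (quotientCase (suc n / b) (m/n*n≤m (suc n) b))
  where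
  quotientCase : ∀ q → q * b ≤ suc n → b ^ length (digitsAux f b q) ≤ suc n
  quotientCase zero    _    =
    subst (λ ds → b ^ length ds ≤ suc n) (sym (digitsAux-zero f b)) (s≤s z≤n)
  quotientCase (suc q) qb≤n = begin
    b ^ length (digitsAux f b (suc q)) ≤⟨ length-digits-lower f b (suc q) (s≤s z≤n) ⟩
    b * suc q                          ≡⟨ *-comm b (suc q) ⟩
    suc q * b                          ≤⟨ qb≤n ⟩
    suc n                              ∎
    where open ≤-Reasoning

sum-digits-upper : ∀ b (ds : List ℕ) → All (_< b) ds → sum ds ≤ (b ∸ 1) * length ds
sum-digits-upper b []       []       = z≤n
sum-digits-upper b (d ∷ ds) (d<b ∷ ps) = begin
  d + sum ds                       ≤⟨ +-mono-≤ (<⇒≤pred d<b) (sum-digits-upper b ds ps) ⟩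
  (b ∸ 1) + (b ∸ 1) * length ds    ≡⟨ sym (*-suc (b ∸ 1) (length ds)) ⟩
  (b ∸ 1) * suc (length ds)        ∎
  where open ≤-Reasoning

-- Reading ℓ digits below b after a prefix of value acc gives less than
-- (acc+1)·b^ℓ; with acc = 0 a most-significant-first value is below b^ℓ.
fromDigits-upper : ∀ b acc (ds : List ℕ) → All (_< b) ds →
  foldl (λ a d → a * b + d) acc ds < suc acc * b ^ length ds
fromDigits-upper b acc []       []         = ≤-reflexive (cong suc (sym (*-identityʳ acc)))
fromDigits-upper b acc (d ∷ ds) (d<b ∷ ps) = begin-strict
  foldl (λ a d → a * b + d) (acc * b + d) ds <⟨ fromDigits-upper b (acc * b + d) ds ps ⟩
  suc (acc * b + d) * b ^ length ds         ≤⟨ *-monoˡ-≤ (b ^ length ds) nextPrefix ⟩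
  (suc acc * b) * b ^ length ds              ≡⟨ *-assoc (suc acc) b (b ^ length ds) ⟩
  suc acc * (b * b ^ length ds)              ∎
  where
  open ≤-Reasoning
  nextPrefix : suc (acc * b + d) ≤ suc acc * b
  nextPrefix = begin
    suc (acc * b + d) ≡⟨ sym (+-suc (acc * b) d) ⟩
    acc * b + suc d   ≤⟨ +-monoʳ-≤ (acc * b) d<b ⟩
    acc * b + b       ≡⟨ +-comm (acc * b) b ⟩
    suc acc * b       ∎

reversal-upper : ∀ b .{{_ : NonZero b}} n → 1 ≤ n → reversal b n ≤ b * n
reversal-upper b n 1≤n = begin
  reversal b n                ≤⟨ <⇒≤ (fromDigits-upper b 0 (digits b n) (digits-< n b n)) ⟩
  1 * b ^ numDigits b n       ≡⟨ *-identityˡ _ ⟩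
  b ^ numDigits b n           ≤⟨ length-digits-lower n b n 1≤n ⟩
  b * n                       ∎
  where open ≤-Reasoning

factor-pos : ∀ m n → 1 ≤ m * n → 1 ≤ m
factor-pos zero    n ()
factor-pos (suc m) n _ = s≤s z≤n

-- With A = M·s_b(N), from N = A·A^R and A^R ≤ b·A:  b^k ≤ b·N ≤ (b·A)².
mrh-lower : ∀ b .{{_ : NonZero b}} N M → 1 ≤ N → IsMultiplier b N M →
  b ^ numDigits b N ≤ sq (b * (M * digitSum b N))
mrh-lower b N M 1≤N (_ , N≡AAᴿ) = begin
  b ^ numDigits b N       ≤⟨ length-digits-lower N b N 1≤N ⟩
  b * N                   ≡⟨ cong (b *_) N≡AAᴿ ⟩
  b * (A * reversal b A)  ≤⟨ *-monoʳ-≤ b (*-monoʳ-≤ A (reversal-upper b A 1≤A)) ⟩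
  b * (A * (b * A))       ≡⟨ cong (b *_) (x∙yz≈y∙xz A b A) ⟩
  b * (b * (A * A))       ≡⟨ sym (*-assoc b b (A * A)) ⟩
  (b * b) * (A * A)       ≡⟨ sym (sq-* b A) ⟩
  sq (b * A)              ∎
  where
  open ≤-Reasoning
  A = M * digitSum b N
  1≤A : 1 ≤ A
  1≤A = factor-pos A (reversal b A) (subst (1 ≤_) N≡AAᴿ 1≤N)

-- From s_b(N) ≤ (b-1)·k and M < b^(L+1):  b·A < b^(L+2)·(b-1)·k.
mrh-upper : ∀ b .{{_ : NonZero b}} → 2 ≤ b → ∀ N M L →
  1 ≤ numDigits b N → M < b ^ suc L →
  b * (M * digitSum b N) < (b ^ (2 + L) * (b ∸ 1)) * numDigits b N
mrh-upper b 2≤b N M L 1≤k M<bᴸ⁺¹ = begin-strict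
  b * (M * digitSum b N)   ≤⟨ *-monoʳ-≤ b (*-monoʳ-≤ M digitSum≤Y) ⟩
  b * (M * Y)              <⟨ *-monoʳ-< b (*-monoˡ-< Y {{>-nonZero 1≤Y}} M<bᴸ⁺¹) ⟩
  b * (X * Y)              ≡⟨ sym (*-assoc b X Y) ⟩
  (b * X) * (C * k)        ≡⟨ sym (*-assoc (b * X) C k) ⟩
  (b * X) * C * k          ∎
  where
  open ≤-Reasoning
  C = b ∸ 1
  k = numDigits b N
  X = b ^ suc L
  Y = C * k
  digitSum≤Y : digitSum b N ≤ Y
  digitSum≤Y = sum-digits-upper b (digits b N) (digits-< N b N)
  1≤Y : 1 ≤ Y
  1≤Y = *-mono-≤ (∸-monoˡ-≤ 1 2≤b) 1≤k

-- b^k dominates at level L: the square of the bound of mrh-upper lies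
-- below b^k, i.e. (b-1)²·k²·b^(2L+4) ≤ b^k.
Dominates : (b L k : ℕ) → Set
Dominates b L k = sq (b ^ (2 + L) * (b ∸ 1)) * sq k ≤ b ^ k

sq-suc-≤ : ∀ k → 3 ≤ k → sq (suc k) ≤ 2 * sq k
sq-suc-≤ k 3≤k with m≤n⇒∃[o]m+o≡n 3≤k
... | t , refl = subst (sq (4 + t) ≤_) (sym (expand t)) (m≤m+n _ _)
  where
  expand : ∀ t → 2 * ((3 + t) * (3 + t)) ≡ (4 + t) * (4 + t) + (t * t + 4 * t + 2)
  expand = solve-∀

sq-+3-≤ : ∀ x → 10 ≤ x → sq (3 + x) ≤ 2 * sq x
sq-+3-≤ x 10≤x with m≤n⇒∃[o]m+o≡n 10≤x
... | t , refl = subst (sq (13 + t) ≤_) (sym (expand t)) (m≤m+n _ _)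
  where
  expand : ∀ t → 2 * ((10 + t) * (10 + t)) ≡ (13 + t) * (13 + t) + (t * t + 14 * t + 31)
  expand = solve-∀

-- Raising k by one multiplies b^k by b but k² by less than b.
dominates-suc : ∀ b L k → 2 ≤ b → 3 ≤ k → Dominates b L k → Dominates b L (suc k)
dominates-suc b L k 2≤b 3≤k dom = begin
  Q * sq (suc k)   ≤⟨ *-monoʳ-≤ Q (≤-trans (sq-suc-≤ k 3≤k) (*-monoˡ-≤ (sq k) 2≤b)) ⟩
  Q * (b * sq k)   ≡⟨ x∙yz≈y∙xz Q b (sq k) ⟩
  b * (Q * sq k)   ≤⟨ *-monoʳ-≤ b dom ⟩
  b * b ^ k        ∎
  where
  open ≤-Reasoning
  Q = sq (b ^ (2 + L) * (b ∸ 1))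

-- Raising L by one and k by three multiplies b^k by b³, while the bound
-- squared gains a factor b² and k² a factor less than b.
dominates-diagonal-step : ∀ b L x → 2 ≤ b → 10 ≤ x →
  Dominates b L x → Dominates b (suc L) (3 + x)
dominates-diagonal-step b L x 2≤b 10≤x dom = begin
  sq ((b * P) * C) * sq (3 + x)   ≤⟨ *-monoʳ-≤ (sq ((b * P) * C)) x+3² ⟩
  sq ((b * P) * C) * (b * sq x)   ≡⟨ regroup b P C (sq x) ⟩
  b * (b * (b * (sq (P * C) * sq x)))
                                  ≤⟨ *-monoʳ-≤ b (*-monoʳ-≤ b (*-monoʳ-≤ b dom)) ⟩
  b * (b * (b * b ^ x))           ∎
  where
  open ≤-Reasoning
  P = b ^ (2 + L)
  C = b ∸ 1
  x+3² : sq (3 + x) ≤ b * sq x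
  x+3² = ≤-trans (sq-+3-≤ x 10≤x) (*-monoˡ-≤ (sq x) 2≤b)
  regroup : ∀ b P C y →
    ((b * P) * C) * ((b * P) * C) * (b * y) ≡ b * (b * (b * ((P * C) * (P * C) * y)))
  regroup = solve-∀

diagonal-≥10 : ∀ L → 3 ≤ L → 10 ≤ 3 * L + 1
diagonal-≥10 L 3≤L = +-monoˡ-≤ 1 (*-monoʳ-≤ 3 3≤L)

diagonal-suc : ∀ L → 3 * suc L + 1 ≡ 3 + (3 * L + 1)
diagonal-suc L = trans (cong (_+ 1) (*-suc 3 L)) (+-assoc 3 (3 * L) 1)

dominates-diagonal : ∀ b L₀ L → 2 ≤ b → 3 ≤ L₀ → L₀ ≤′ L →
  Dominates b L₀ (3 * L₀ + 1) → Dominates b L (3 * L + 1)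
dominates-diagonal b L₀ .L₀ 2≤b 3≤L₀ ≤′-refl base = base
dominates-diagonal b L₀ (suc L) 2≤b 3≤L₀ (≤′-step L₀≤′L) base =
  subst (Dominates b (suc L)) (sym (diagonal-suc L))
    (dominates-diagonal-step b L (3 * L + 1) 2≤b
      (diagonal-≥10 L (≤-trans 3≤L₀ (≤′⇒≤ L₀≤′L)))
      (dominates-diagonal b L₀ L 2≤b 3≤L₀ L₀≤′L base))

dominates-upward : ∀ b L k k′ → 2 ≤ b → 3 ≤ k → k ≤′ k′ →
  Dominates b L k → Dominates b L k′
dominates-upward b L k .k 2≤b 3≤k ≤′-refl dom = dom
dominates-upward b L k (suc k′) 2≤b 3≤k (≤′-step k≤′k′) dom =
  dominates-suc b L k′ 2≤b (≤-trans 3≤k (≤′⇒≤ k≤′k′))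
    (dominates-upward b L k k′ 2≤b 3≤k k≤′k′ dom)

dominates-region : ∀ b L₀ → 2 ≤ b → 3 ≤ L₀ → Dominates b L₀ (3 * L₀ + 1) →
  ∀ L k → L₀ ≤ L → 3 * L + 1 ≤ k → Dominates b L k
dominates-region b L₀ 2≤b 3≤L₀ base L k L₀≤L 3L+1≤k =
  dominates-upward b L (3 * L + 1) k 2≤b
    (≤-trans (≤ᵇ⇒≤ 3 10 tt) (diagonal-≥10 L (≤-trans 3≤L₀ L₀≤L))) (≤⇒≤′ 3L+1≤k)
    (dominates-diagonal b L₀ L 2≤b 3≤L₀ (≤⇒≤′ L₀≤L) base)

-- For b ≥ 9 at level 9:  (b-1)²·28²·b²² ≤ b²⁴·b⁴ = b²⁸, since 28² ≤ 9⁴ ≤ b⁴.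
dominates-large-base : ∀ b → 9 ≤ b → Dominates b 9 28
dominates-large-base b 9≤b = begin
  sq (b ^ 11 * (b ∸ 1)) * sq 28  ≤⟨ *-mono-≤ (*-mono-≤ b¹¹C≤b¹² b¹¹C≤b¹²) 28²≤b⁴ ⟩
  sq (b ^ 11 * b) * b ^ 4        ≡⟨ cong (λ y → sq y * b ^ 4) (*-comm (b ^ 11) b) ⟩
  sq (b ^ 12) * b ^ 4            ≡⟨ cong (_* b ^ 4) (sym (^-distribˡ-+-* b 12 12)) ⟩
  b ^ 24 * b ^ 4                 ≡⟨ sym (^-distribˡ-+-* b 24 4) ⟩
  b ^ 28                         ∎
  where
  open ≤-Reasoning
  b¹¹C≤b¹² : b ^ 11 * (b ∸ 1) ≤ b ^ 11 * b
  b¹¹C≤b¹² = *-monoʳ-≤ (b ^ 11) (m∸n≤m b 1)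
  28²≤b⁴ : sq 28 ≤ b ^ 4
  28²≤b⁴ = ≤-trans (≤ᵇ⇒≤ (sq 28) (9 ^ 4) tt) (^-monoˡ-≤ 4 9≤b)

dominates-middle-base : ∀ d → d ≤ 3 → Dominates (5 + d) 10 31
dominates-middle-base 0 _ = ≤ᵇ⇒≤ _ _ tt
dominates-middle-base 1 _ = ≤ᵇ⇒≤ _ _ tt
dominates-middle-base 2 _ = ≤ᵇ⇒≤ _ _ tt
dominates-middle-base 3 _ = ≤ᵇ⇒≤ _ _ tt
dominates-middle-base (suc (suc (suc (suc d)))) (s≤s (s≤s (s≤s ())))

LargeMultiplier : (b M : ℕ) → Set
LargeMultiplier b M =
  (9 ≤ b × b ^ 9 ≤ M) ⊎ ((5 ≤ b × b ≤ 8) × b ^ 10 ≤ M) ⊎ (b ≡ 4 × b ^ 11 ≤ M)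
  ⊎ (b ≡ 3 × b ^ 12 ≤ M) ⊎ (b ≡ 2 × b ^ 16 ≤ M)

threshold : ∀ b M → LargeMultiplier b M →
  ∃[ L₀ ] 3 ≤ L₀ × b ^ L₀ ≤ M × Dominates b L₀ (3 * L₀ + 1)
threshold b M (inj₁ (9≤b , bᴸ⁰≤M)) =
  9 , ≤ᵇ⇒≤ _ _ tt , bᴸ⁰≤M , dominates-large-base b 9≤b
threshold b M (inj₂ (inj₁ ((5≤b , b≤8) , bᴸ⁰≤M))) =
  10 , ≤ᵇ⇒≤ _ _ tt , bᴸ⁰≤M ,
  subst (λ c → Dominates c 10 31) (m+[n∸m]≡n 5≤b)
    (dominates-middle-base (b ∸ 5) (∸-monoˡ-≤ 5 b≤8))
threshold b M (inj₂ (inj₂ (inj₁ (refl , bᴸ⁰≤M)))) =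
  11 , ≤ᵇ⇒≤ _ _ tt , bᴸ⁰≤M , ≤ᵇ⇒≤ _ _ tt
threshold b M (inj₂ (inj₂ (inj₂ (inj₁ (refl , bᴸ⁰≤M))))) =
  12 , ≤ᵇ⇒≤ _ _ tt , bᴸ⁰≤M , ≤ᵇ⇒≤ _ _ tt
threshold b M (inj₂ (inj₂ (inj₂ (inj₂ (refl , bᴸ⁰≤M))))) =
  16 , ≤ᵇ⇒≤ _ _ tt , bᴸ⁰≤M , ≤ᵇ⇒≤ _ _ tt

exponent-≤ : ∀ b .{{_ : NonZero b}} L₀ L M → b ^ L₀ ≤ M → M < b ^ suc L → L₀ ≤ L
exponent-≤ b L₀ L M bᴸ⁰≤M M<bᴸ⁺¹ =
  ≮⇒≥ λ L<L₀ → <⇒≱ M<bᴸ⁺¹ (≤-trans (^-monoʳ-≤ b L<L₀) bᴸ⁰≤M)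

-- With A = M·s_b(N): if k ≥ 3L+1 then b^k ≤ (b·A)² < (b^(L+2)(b-1)k)² ≤ b^k.
theorem40 : (b : ℕ) → .{{_ : NonZero b}} → 2 ≤ b →
    (N M k : ℕ) → 1 ≤ N → IsMultiplier b N M → numDigits b N ≡ k →
    ((9 ≤ b × b ^ 9 ≤ M) ⊎ ((5 ≤ b × b ≤ 8) × b ^ 10 ≤ M) ⊎ (b ≡ 4 × b ^ 11 ≤ M)
    ⊎ (b ≡ 3 × b ^ 12 ≤ M) ⊎ (b ≡ 2 × b ^ 16 ≤ M)) →
    (L : ℕ) → b ^ L ≤ M → M < b ^ suc L →
    k ≤ 3 * L
theorem40 b 2≤b N M k 1≤N isMultiplier refl large L bᴸ≤M M<bᴸ⁺¹
  with threshold b M large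
... | L₀ , 3≤L₀ , bᴸ⁰≤M , base = ≮⇒≥ k-too-large
  where
  k-too-large : 3 * L < k → ⊥
  k-too-large 3L<k = <-irrefl refl (begin-strict
    b ^ k                                        ≤⟨ mrh-lower b N M 1≤N isMultiplier ⟩
    sq (b * (M * digitSum b N))                  <⟨ *-mono-< bA<bound bA<bound ⟩
    sq (b ^ (2 + L) * (b ∸ 1) * k)               ≡⟨ sq-* (b ^ (2 + L) * (b ∸ 1)) k ⟩
    sq (b ^ (2 + L) * (b ∸ 1)) * sq k            ≤⟨ dominates-region b L₀ 2≤b 3≤L₀ base L k
                                                      (exponent-≤ b L₀ L M bᴸ⁰≤M M<bᴸ⁺¹) 3L+1≤k ⟩
    b ^ k                                        ∎)
    where
    open ≤-Reasoning
    3L+1≤k : 3 * L + 1 ≤ k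
    3L+1≤k = subst (_≤ k) (+-comm 1 (3 * L)) 3L<k
    bA<bound : b * (M * digitSum b N) < b ^ (2 + L) * (b ∸ 1) * k
    bA<bound = mrh-upper b 2≤b N M L (≤-trans (m≤n+m 1 (3 * L)) 3L+1≤k) M<bᴸ⁺¹
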